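{- If $\mathcal{U}=\langle X,Y,\le_X,\le_Y,\tau_X,\tau_Y,R,T\rangle$ is an Urquhart space, then $\langle X,Y,\le_X,\le_Y,R,T\rangle$ is a FI-frame.
   Context: For a Priestley space $\langle X,\le,\tau\rangle$, $\mathcal{C}(X)$ is the bounded distributive lattice of clopen increasing subsets and $\epsilon_X(x)=\{U\in\mathcal{C}(X):x\in U\}$ (a prime filter of $\mathcal{C}(X)$). An Urquhart space is $\mathcal{U}=\langle X,Y,\le_X,\le_Y,\tau_X,\tau_Y,R,T\rangle$ such that: (1) $\langle X,\le_X,\tau_X\rangle$, $\langle Y,\le_Y,\tau_Y\rangle$ are Priestley spaces; (2) $R\subseteq X\times Y\times X$, $T\subseteq Y\times X\times X$; (3) for every $U\in\mathcal{C}(Y)$, $V\in\mathcal{C}(X)$, the sets $f(V,U)=\{z\in X:\exists(x,y)\in V\times U,\ (x,y,z)\in R\}$ and $i(U,V)=\{y\in X:\forall x\in Y\,\forall z\in X\,(((x,y,z)\in T\text{ and }x\in U)\Rightarrow z\in V)\}$ belong to $\mathcal{C}(X)$; (4) for all $x\in Y$, $y,z\in X$, if $f(\epsilon_X(y),\epsilon_Y(x))\subseteq\epsilon_X(z)$ then $(y,x,z)\in R$; (5) for all $x\in Y$, $y,z\in X$, if $i(\epsilon_Y(x),\epsilon_X(y))\subseteq\epsilon_X(z)$ then $(x,y,z)\in T$. In (4) and (5), for filters $G$ of $\mathcal{C}(X)$ and $H$ of $\mathcal{C}(Y)$, $f(G,H)=\{W\in\mathcal{C}(X):\exists(S,Q)\in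 G\times H,\ f(S,Q)\subseteq W\}$ and $i(H,G)=\{W\in\mathcal{C}(X):\exists(Q,S)\in H\times G,\ S\subseteq i(Q,W)\}$. A FI-frame is $\langle X,Y,\le_X,\le_Y,R,T\rangle$ with posets $X,Y$, $R\subseteq X\times Y\times X$, $T\subseteq Y\times X\times X$ such that: $(x,y,z)\in R$, $\bar x\le_X x$, $\bar y\le_Y y$, $z\le_X\bar z$ imply $(\bar x,\bar y,\bar z)\in R$; $(y,x,z)\in T$, $\bar y\le_Y y$, $\bar x\le_X x$, $z\le_X\bar z$ imply $(\bar y,\bar x,\bar z)\in T$. -}

module Defs where

open import Data.Empty using (⊥)
open import Data.Unit using (⊤)
open import Data.Product using (Σ; _×_)
open import Data.List using (List)
open import Data.List.Relation.Unary.Any using (Any)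
open import Relation.Nullary using (¬_)
open import Relation.Binary.PropositionalEquality using (_≡_)
open import Relation.Binary.Structures using (IsPartialOrder)

Subset : Set → Set₁
Subset X = X → Set

_⊆_ : {X : Set} → Subset X → Subset X → Set
U ⊆ V = ∀ x → U x → V x

∁ : {X : Set} → Subset X → Subset X
∁ U x = ¬ U x

record Topology (X : Set) : Set₁ where
  field
    Open     : Subset X → Set
    open-ext : ∀ {U V : Subset X} → U ⊆ V → V ⊆ U → Open U → Open V
    open-∅   : Open (λ _ → ⊥)
    open-X   : Open (λ _ → ⊤)
    open-∩   : ∀ {U V : Subset X} → Open U → Open V → Open (λ x → U x × V x)
    open-⋃   : ∀ {I : Set} (U : I → Subset X) → (∀ i → Open (U i))
               → Open (λ x → Σ I (λ i → U i x))
open Topology public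

Clopen : {X : Set} → Topology X → Subset X → Set
Clopen τ U = Open τ U × Open τ (∁ U)

Compact : {X : Set} → Topology X → Set₁
Compact {X} τ = ∀ {I : Set} (U : I → Subset X) → (∀ i → Open τ (U i))
  → (∀ x → Σ I (λ i → U i x))
  → Σ (List I) (λ is → ∀ x → Any (λ i → U i x) is)

Increasing : {X : Set} → (X → X → Set) → Subset X → Set
Increasing {X} _≤_ U = ∀ {x y : X} → x ≤ y → U x → U y

InC : {X : Set} → (X → X → Set) → Topology X → Subset X → Set
InC _≤_ τ U = Clopen τ U × Increasing _≤_ U

record IsPriestley {X : Set} (_≤_ : X → X → Set) (τ : Topology X) : Set₁ where
  field
    isPartialOrder : IsPartialOrder _≡_ _≤_
    compact        : Compact τ
    separation     : ∀ (x y : X) → ¬ (x ≤ y)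
                     → Σ (Subset X) (λ U → InC _≤_ τ U × U x × ¬ U y)

ε : {X : Set} → (X → X → Set) → Topology X → X → Subset X → Set
ε _≤_ τ x U = InC _≤_ τ U × U x

_⊆₁_ : {X : Set} → (Subset X → Set) → (Subset X → Set) → Set₁
A ⊆₁ B = ∀ W → A W → B W

fR : {X Y : Set} → (X → Y → X → Set) → Subset X → Subset Y → Subset X
fR {X} {Y} R V U z = Σ X (λ x → Σ Y (λ y → V x × U y × R x y z))

iT : {X Y : Set} → (Y → X → X → Set) → Subset Y → Subset X → Subset X
iT {X} {Y} T U V y = ∀ (x : Y) (z : X) → T x y z → U x → V z

record UrquhartSpace : Set₂ where
  field
    X Y : Set
    _≤X_ : X → X → Set
    _≤Y_ : Y → Y → Set
    τX : Topology X
    τY : Topology Y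
    priestleyX : IsPriestley _≤X_ τX
    priestleyY : IsPriestley _≤Y_ τY
    R : X → Y → X → Set
    T : Y → X → X → Set
    f-C : ∀ (U : Subset Y) (V : Subset X) → InC _≤Y_ τY U → InC _≤X_ τX V
          → InC _≤X_ τX (fR R V U)
    i-C : ∀ (U : Subset Y) (V : Subset X) → InC _≤Y_ τY U → InC _≤X_ τX V
          → InC _≤X_ τX (iT T U V)

  fF : (Subset X → Set) → (Subset Y → Set) → Subset X → Set₁
  fF G H W = InC _≤X_ τX W
    × Σ (Subset X) (λ S → Σ (Subset Y) (λ Q → G S × H Q × (fR R S Q ⊆ W)))

  iF : (Subset Y → Set) → (Subset X → Set) → Subset X → Set₁
  iF H G W = InC _≤X_ τX W
    × Σ (Subset Y) (λ Q → Σ (Subset X) (λ S → H Q × G S × (S ⊆ iT T Q W)))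

  field
    R-closed : ∀ (x : Y) (y z : X)
      → (∀ W → fF (ε _≤X_ τX y) (ε _≤Y_ τY x) W → ε _≤X_ τX z W) → R y x z
    T-closed : ∀ (x : Y) (y z : X)
      → (∀ W → iF (ε _≤Y_ τY x) (ε _≤X_ τX y) W → ε _≤X_ τX z W) → T x y z

record IsFIFrame {X Y : Set} (_≤X_ : X → X → Set) (_≤Y_ : Y → Y → Set)
                 (R : X → Y → X → Set) (T : Y → X → X → Set) : Set where
  field
    R-mono : ∀ {x x̄ z z̄ : X} {y ȳ : Y} → R x y z → x̄ ≤X x → ȳ ≤Y y → z ≤X z̄
             → R x̄ ȳ z̄
    T-mono : ∀ {x x̄ z z̄ : X} {y ȳ : Y} → T y x z → ȳ ≤Y y → x̄ ≤X x → z ≤X z̄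
             → T ȳ x̄ z̄

{-# OPTIONS --safe #-}
module Submission where

open import Defs
open import Data.Product using (_,_; proj₂)

-- R and T are determined by the point-filters of their arguments; shrinking the
-- inputs shrinks these filters and enlarging the output enlarges its filter, so
-- the closure conditions (4) and (5) of an Urquhart space force both relations to
-- be antitone in the inputs and monotone in the output. For T this needs i(Q,W)
-- to be increasing, which is part of condition (3).

module _ {X : Set} {_≤_ : X → X → Set} (τ : Topology X) where

  ε-mono : ∀ {x y : X} → x ≤ y → ε _≤_ τ x ⊆₁ ε _≤_ τ y
  ε-mono x≤y U (U∈𝒞 , Ux) = U∈𝒞 , proj₂ U∈𝒞 x≤y Ux

  ε-intro : ∀ {x y : X} {U : Subset X} → InC _≤_ τ U → U x → x ≤ y → ε _≤_ τ y U
  ε-intro U∈𝒞 Ux x≤y = ε-mono x≤y _ (U∈𝒞 , Ux)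

module _ (𝒰 : UrquhartSpace) where
  open UrquhartSpace 𝒰

  iT-increasing : ∀ {Q : Subset Y} {W : Subset X} → InC _≤Y_ τY Q → InC _≤X_ τX W
                  → Increasing _≤X_ (iT T Q W)
  iT-increasing Q∈𝒞 W∈𝒞 = proj₂ (i-C _ _ Q∈𝒞 W∈𝒞)

  f-ε-⊆-ε : ∀ {x x̄ z z̄ : X} {y ȳ : Y} → R x y z → x̄ ≤X x → ȳ ≤Y y → z ≤X z̄
            → ∀ W → fF (ε _≤X_ τX x̄) (ε _≤Y_ τY ȳ) W → ε _≤X_ τX z̄ W
  f-ε-⊆-ε {x} {y = y} Rxyz x̄≤x ȳ≤y z≤z̄ W (W∈𝒞 , S , Q , S∋x̄ , Q∋ȳ , fSQ⊆W) =
    ε-intro τX W∈𝒞 (fSQ⊆W _ (x , y , Sx , Qy , Rxyz)) z≤z̄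
    where
    Sx : S x
    Sx = proj₂ (ε-mono τX x̄≤x S S∋x̄)
    Qy : Q y
    Qy = proj₂ (ε-mono τY ȳ≤y Q Q∋ȳ)

  i-ε-⊆-ε : ∀ {x x̄ z z̄ : X} {y ȳ : Y} → T y x z → ȳ ≤Y y → x̄ ≤X x → z ≤X z̄
            → ∀ W → iF (ε _≤Y_ τY ȳ) (ε _≤X_ τX x̄) W → ε _≤X_ τX z̄ W
  i-ε-⊆-ε {x} {x̄} {z} {y = y} Tyxz ȳ≤y x̄≤x z≤z̄ W
          (W∈𝒞 , Q , S , (Q∈𝒞 , Qȳ) , (_ , Sx̄) , S⊆iQW) =
    ε-intro τX W∈𝒞 (iQWx y z Tyxz Qy) z≤z̄
    where
    iQWx : iT T Q W x
    iQWx = iT-increasing Q∈𝒞 W∈𝒞 x̄≤x (S⊆iQW x̄ Sx̄)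
    Qy : Q y
    Qy = proj₂ (ε-mono τY ȳ≤y Q (Q∈𝒞 , Qȳ))

lemma5p2 : (𝒰 : UrquhartSpace) → IsFIFrame (UrquhartSpace._≤X_ 𝒰) (UrquhartSpace._≤Y_ 𝒰) (UrquhartSpace.R 𝒰) (UrquhartSpace.T 𝒰)
lemma5p2 𝒰 = record
  { R-mono = λ Rxyz x̄≤x ȳ≤y z≤z̄ → R-closed _ _ _ (f-ε-⊆-ε 𝒰 Rxyz x̄≤x ȳ≤y z≤z̄)
  ; T-mono = λ Tyxz ȳ≤y x̄≤x z≤z̄ → T-closed _ _ _ (i-ε-⊆-ε 𝒰 Tyxz ȳ≤y x̄≤x z≤z̄)
  }
  where open UrquhartSpace 𝒰
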